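{- For every $\epsilon>0$, there is a variable-length (deterministic) protocol for message exchange in the adaptive feedback model over a ternary alphabet that is resilient to a $\frac12-\epsilon$ fraction of errors.
   Context: Message exchange: Alice holds $x\in\{0,1\}^n$, Bob holds $y\in\{0,1\}^n$, and the goal is that both parties output $(x,y)$. Adaptive feedback model: in each round a single party sends one symbol of an alphabet $\Sigma$ to the other party, and the sender learns what the other party actually received, so both parties share the transcript $T$ of received symbols. The speaker of each round is a function of $T$, and the (common) decision to terminate is a function of $T$. The adversary may corrupt any transmitted symbol. The protocol is resilient to an $\alpha$ fraction of errors if for all $x,y$ and all adversarial attacks in which the parties terminate at round $R$, if the number of corrupted rounds is at most $\alpha R$ then both parties output $(x,y)$. Here $|\Sigma|=3$. -}

module Defs where

open import Data.Bool using (Bool; true; false; if_then_else_)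
open import Data.Nat using (ℕ; zero; suc; _+_)
open import Data.Fin using (Fin)
open import Data.Fin.Properties using (_≟_)
open import Data.Vec using (Vec)
open import Data.List using (List; []; _∷_; _++_; [_]; length; applyUpTo)
open import Data.Product using (_×_; _,_; ∃)
open import Data.Unit using (⊤)
open import Data.Integer using (+_)
open import Data.Rational using (ℚ; _/_; _≤_)
open import Relation.Nullary using (yes; no)
open import Relation.Binary.PropositionalEquality using (_≡_)

Sym : Set
Sym = Fin 3

Bits : ℕ → Set
Bits n = Vec Bool n

-- Shared transcript of *received* symbols, in chronological order
-- (earliest symbol first).
Transcript : Set
Transcript = List Sym

data Party : Set where
  alice bob : Party

record Protocol (n : ℕ) : Set where
  field
    speaker   : Transcript → Party
    halt      : Transcript → Bool
    aliceSend : Bits n → Transcript → Sym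
    bobSend   : Bits n → Transcript → Sym
    aliceOut  : Bits n → Transcript → Bits n × Bits n
    bobOut    : Bits n → Transcript → Bits n × Bits n

module _ {n : ℕ} (P : Protocol n) where
  open Protocol P

  sent : Bits n → Bits n → Transcript → Sym
  sent x y T with speaker T
  ... | alice = aliceSend x T
  ... | bob   = bobSend y T

  corruptionsFrom : Bits n → Bits n → Transcript → List Sym → ℕ
  corruptionsFrom x y T []      = 0
  corruptionsFrom x y T (s ∷ r) with sent x y T ≟ s
  ... | yes _ = corruptionsFrom x y (T ++ [ s ]) r
  ... | no  _ = suc (corruptionsFrom x y (T ++ [ s ]) r)

  corruptions : Bits n → Bits n → Transcript → ℕ
  corruptions x y r = corruptionsFrom x y [] r

  runsFrom : Transcript → List Sym → Set
  runsFrom T []      = ⊤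
  runsFrom T (s ∷ r) = halt T ≡ false × runsFrom (T ++ [ s ]) r

  -- r is the full received transcript of an execution terminating at
  -- round R = length r (for some attack of the adversary).
  TerminatingRun : Transcript → Set
  TerminatingRun r = runsFrom [] r × halt r ≡ true

  AlwaysTerminates : Set
  AlwaysTerminates = (f : ℕ → Sym) → ∃ λ k → halt (applyUpTo f k) ≡ true

  Resilient : ℚ → Set
  Resilient α =
    (x y : Bits n) (r : Transcript) → TerminatingRun r →
    (+ corruptions x y r / 1) ≤ α Data.Rational.* (+ length r / 1) →
    (aliceOut x r ≡ (x , y)) × (bobOut y r ≡ (x , y))

-- Alice first sends x and then Bob sends y, each over a channel whose receiver keeps a stack of the
-- symbols received, the symbol 2 acting as a backspace.  Thanks to the feedback the sender sees this
-- stack: she sends the next bit of her input while the stack is a correct prefix of it, and a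
-- backspace otherwise.  The potential 2·(length of the correct bottom segment) − (stack length) then
-- rises by one in every uncorrupted round and drops by at most one in every corrupted round.  A
-- phase ends when its stack reaches length M = 2qn or after N = q(n + M) rounds, where ε = p/q.  If
-- the correct segment were shorter than n at the end of a phase, the potential would force
-- R + t ≤ K + 2b for the R rounds and b corruptions of the run, with qK ≤ R and t ≥ 1
-- (K = 2n if the stack filled up, K = n + M if the rounds ran out), contradicting b ≤ (½ − 1/q)R.
module Submission where

open import Defs
open import Data.Nat using (ℕ)
open import Data.Product using (Σ; _×_)
open import Data.Rational using (ℚ; 0ℚ; ½; _-_; _<_)

open import Data.Bool using (Bool; true; false; if_then_else_)
open import Data.Nat as ℕ using (zero; suc; _+_; _*_; _≤_; z≤n; s≤s; _<?_; _≤?_)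
open import Data.Nat.Properties hiding (_≟_)
open import Data.Nat.Tactic.RingSolver using (solve-∀)
open import Data.Nat.Coprimality using (Coprime; 1-coprimeTo) renaming (sym to coprime-sym)
open import Data.Fin using (zero; suc; toℕ)
open import Data.Fin.Properties using (_≟_; toℕ<n)
open import Data.List using (List; []; _∷_; _++_; [_]; length; foldl; applyUpTo)
open import Data.List.Properties using (++-assoc; ++-identityʳ; foldl-∷ʳ; length-++; length-applyUpTo)
open import Data.Vec using ([]; _∷_; lookup; tabulate)
open import Data.Vec.Properties using (tabulate-cong; tabulate∘lookup)
open import Data.Product using (_,_; proj₁; proj₂)
open import Data.Sum using (_⊎_; inj₁; inj₂)
open import Data.Empty using (⊥; ⊥-elim)
open import Data.Integer as ℤ using (ℤ; +_; +[1+_]; -[1+_])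
import Data.Integer.Properties as ℤ
import Data.Integer.Tactic.RingSolver as ℤ-Solver
open import Data.Rational as ℚ using (mkℚ; _/_; toℚᵘ)
open import Data.Rational.Properties using (normalize-coprime; toℚᵘ-mono-≤; toℚᵘ-homo-*; toℚᵘ-homo-+; toℚᵘ-homo‿-)
import Data.Rational.Unnormalised as ℚᵘ
import Data.Rational.Unnormalised.Properties as ℚᵘ
open import Function using (_∘_)
open import Relation.Nullary using (¬_; Dec; yes; no; contradiction)
open import Relation.Nullary.Decidable using (_×-dec_)
open import Relation.Binary.PropositionalEquality hiding ([_])

m≤n⇒2m+[1+o]≤1+2n+o : ∀ {m n} o → m ≤ n → 2 * m + suc o ≤ suc (2 * n) + o
m≤n⇒2m+[1+o]≤1+2n+o {m} {n} o m≤n = begin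
  2 * m + suc o   ≤⟨ +-monoˡ-≤ (suc o) (*-monoʳ-≤ 2 m≤n) ⟩
  2 * n + suc o   ≡⟨ +-suc (2 * n) o ⟩
  suc (2 * n) + o ∎
  where open ≤-Reasoning

m≤1+n⇒2m+o≤1+2n+[1+o] : ∀ {m n} o → m ≤ suc n → 2 * m + o ≤ suc (2 * n) + suc o
m≤1+n⇒2m+o≤1+2n+[1+o] {m} {n} o m≤1+n = begin
  2 * m + o             ≤⟨ +-monoˡ-≤ o (*-monoʳ-≤ 2 m≤1+n) ⟩
  2 * suc n + o         ≡⟨ cong (_+ o) (*-suc 2 n) ⟩
  suc (suc (2 * n + o)) ≡⟨ cong suc (sym (+-suc (2 * n) o)) ⟩
  suc (2 * n) + suc o   ∎
  where open ≤-Reasoning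

+-≤-trans-cancel : ∀ {x y z w u v} → x + y ≤ z + w → z + v ≤ u + y → x + v ≤ u + w
+-≤-trans-cancel {x} {y} {z} {w} {u} {v} x+y≤z+w z+v≤u+y = +-cancelʳ-≤ (z + y) (x + v) (u + w) (begin
  x + v + (z + y)   ≡⟨ swap x y z v ⟩
  x + y + (z + v)   ≤⟨ +-mono-≤ x+y≤z+w z+v≤u+y ⟩
  z + w + (u + y)   ≡⟨ swap′ z w u y ⟩
  u + w + (z + y)   ∎)
  where
  open ≤-Reasoning
  swap : ∀ a b c d → a + d + (c + b) ≡ a + b + (c + d)
  swap = solve-∀
  swap′ : ∀ a b c d → a + b + (c + d) ≡ c + b + (a + d)
  swap′ = solve-∀

backspace : Sym
backspace = suc (suc zero)

encodeBit : Bool → Sym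
encodeBit false = zero
encodeBit true  = suc zero

decodeBit : Sym → Bool
decodeBit zero = false
decodeBit _    = true

decodeBit∘encodeBit : ∀ b → decodeBit (encodeBit b) ≡ b
decodeBit∘encodeBit false = refl
decodeBit∘encodeBit true  = refl

-- The receiver's stack, most recent symbol first.
edit : Sym → List Sym → List Sym
edit zero             S       = zero ∷ S
edit (suc zero)       S       = suc zero ∷ S
edit (suc (suc zero)) []      = []
edit (suc (suc zero)) (_ ∷ S) = S

edit-encodeBit : ∀ b S → edit (encodeBit b) S ≡ encodeBit b ∷ S
edit-encodeBit false S = refl
edit-encodeBit true  S = refl

length-edit : ∀ c S → length (edit c S) ≤ suc (length S)
length-edit zero             S       = ≤-refl
length-edit (suc zero)       S       = ≤-refl
length-edit (suc (suc zero)) []      = z≤n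
length-edit (suc (suc zero)) (_ ∷ S) = m≤n⇒m≤1+n (n≤1+n _)

-- Indexed from the bottom of the stack; zero is a junk value beyond its top.
symbolAt : List Sym → ℕ → Sym
symbolAt []      i = zero
symbolAt (c ∷ S) i with i ℕ.≟ length S
... | yes _ = c
... | no  _ = symbolAt S i

module _ (m : ℕ → Bool) where

  correct : List Sym → Bool
  correct []      = true
  correct (c ∷ S) with c ≟ encodeBit (m (length S))
  ... | yes _ = correct S
  ... | no  _ = false

  correctLength : List Sym → ℕ
  correctLength []      = 0
  correctLength (c ∷ S) = if correct (c ∷ S) then suc (length S) else correctLength S

  nextSymbol : List Sym → Sym
  nextSymbol S = if correct S then encodeBit (m (length S)) else backspace

  correctLength≤length : ∀ S → correctLength S ≤ length S
  correctLength≤length []      = z≤n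
  correctLength≤length (c ∷ S) with correct (c ∷ S)
  ... | true  = ≤-refl
  ... | false = m≤n⇒m≤1+n (correctLength≤length S)

  correct-head : ∀ c S → correct (c ∷ S) ≡ true → c ≡ encodeBit (m (length S))
  correct-head c S h with c ≟ encodeBit (m (length S))
  correct-head c S h  | yes c≡ = c≡
  correct-head c S () | no  _

  correct-tail : ∀ c S → correct (c ∷ S) ≡ true → correct S ≡ true
  correct-tail c S h with c ≟ encodeBit (m (length S))
  correct-tail c S h  | yes _ = h
  correct-tail c S () | no  _

  correct-push : ∀ S → correct S ≡ true → correct (encodeBit (m (length S)) ∷ S) ≡ true
  correct-push S h with encodeBit (m (length S)) ≟ encodeBit (m (length S))
  ... | yes _  = h
  ... | no  ≢ = contradiction refl ≢

  correct⇒correctLength≡length : ∀ S → correct S ≡ true → correctLength S ≡ length S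
  correct⇒correctLength≡length []      h = refl
  correct⇒correctLength≡length (c ∷ S) h rewrite h = refl

  correctLength-push : ∀ c S → correctLength S ≤ correctLength (c ∷ S)
  correctLength-push c S with correct (c ∷ S)
  ... | true  = m≤n⇒m≤1+n (correctLength≤length S)
  ... | false = ≤-refl

  correctLength-pop : ∀ c S → correctLength (c ∷ S) ≤ suc (correctLength S)
  correctLength-pop c S with correct (c ∷ S) in e
  ... | true  = s≤s (≤-reflexive (sym (correct⇒correctLength≡length S (correct-tail c S e))))
  ... | false = n≤1+n _

  -- The potential 2·correctLength − length falls by at most one under any edit and rises by one
  -- under nextSymbol; both bounds are stated without subtraction.
  correctLength-edit : ∀ c S →
    2 * correctLength S + length (edit c S) ≤ suc (2 * correctLength (edit c S)) + length S
  correctLength-edit zero             S       = m≤n⇒2m+[1+o]≤1+2n+o (length S) (correctLength-push zero S)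
  correctLength-edit (suc zero)       S       = m≤n⇒2m+[1+o]≤1+2n+o (length S) (correctLength-push (suc zero) S)
  correctLength-edit (suc (suc zero)) []      = z≤n
  correctLength-edit (suc (suc zero)) (c ∷ S) = m≤1+n⇒2m+o≤1+2n+[1+o] (length S) (correctLength-pop c S)

  correctLength-edit-nextSymbol : ∀ S →
    2 * correctLength S + suc (length (edit (nextSymbol S) S)) ≤ 2 * correctLength (edit (nextSymbol S) S) + length S
  correctLength-edit-nextSymbol S with correct S in e
  correctLength-edit-nextSymbol S       | true
    rewrite edit-encodeBit (m (length S)) S | correct-push S e | correct⇒correctLength≡length S e =
      ≤-reflexive (eq (length S))
    where
    eq : ∀ s → 2 * s + suc (suc s) ≡ 2 * suc s + s
    eq = solve-∀
  correctLength-edit-nextSymbol (c ∷ S) | false rewrite e = ≤-refl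

  symbolAt-correct : ∀ S {i} → i ℕ.< correctLength S → symbolAt S i ≡ encodeBit (m i)
  symbolAt-correct (c ∷ S) {i} i< with correct (c ∷ S) in e | i ℕ.≟ length S
  ... | true  | yes refl = correct-head c S e
  ... | true  | no  i≢s  =
    symbolAt-correct S (subst (i ℕ.<_) (sym (correct⇒correctLength≡length S (correct-tail c S e)))
                                     (≤∧≢⇒< (≤-pred i<) i≢s))
  ... | false | yes refl = contradiction i< (<⇒≱ (s≤s (correctLength≤length S)))
  ... | false | no  _    = symbolAt-correct S i<

bit : ∀ {n} → Bits n → ℕ → Bool
bit []      i       = false
bit (b ∷ v) zero    = b
bit (b ∷ v) (suc i) = bit v i

bit-toℕ : ∀ {n} (v : Bits n) i → bit v (toℕ i) ≡ lookup v i
bit-toℕ (b ∷ v) zero    = refl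
bit-toℕ (b ∷ v) (suc i) = bit-toℕ v i

decode : (n : ℕ) → List Sym → Bits n
decode n S = tabulate (λ i → decodeBit (symbolAt S (toℕ i)))

decode-correct : ∀ {n} (x : Bits n) S → n ≤ correctLength (bit x) S → decode n S ≡ x
decode-correct x S n≤ = trans (tabulate-cong decodes-bit) (tabulate∘lookup x)
  where
  decodes-bit : ∀ i → decodeBit (symbolAt S (toℕ i)) ≡ lookup x i
  decodes-bit i = begin
    decodeBit (symbolAt S (toℕ i))         ≡⟨ cong decodeBit (symbolAt-correct (bit x) S (<-≤-trans (toℕ<n i) n≤)) ⟩
    decodeBit (encodeBit (bit x (toℕ i))) ≡⟨ decodeBit∘encodeBit _ ⟩
    bit x (toℕ i)                         ≡⟨ bit-toℕ x i ⟩
    lookup x i                            ∎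
    where open ≡-Reasoning

record Channel : Set where
  constructor channel
  field
    stack  : List Sym
    rounds : ℕ
open Channel public

receive : Sym → Channel → Channel
receive c h = channel (edit c (stack h)) (suc (rounds h))

-- b bounds the number of corrupted symbols the channel has received.
Good : (ℕ → Bool) → ℕ → Channel → Set
Good m b h = rounds h + length (stack h) ≤ 2 * correctLength m (stack h) + 2 * b

Good-receive-nextSymbol : ∀ {m b} h → Good m b h → Good m b (receive (nextSymbol m (stack h)) h)
Good-receive-nextSymbol {m} {b} h good = subst (_≤ 2 * c′ + 2 * b) (+-suc (rounds h) (length S′))
  (+-≤-trans-cancel {rounds h} {length S} {2 * c} {2 * b} {2 * c′} good (correctLength-edit-nextSymbol m S))
  where
  S = stack h
  S′ = edit (nextSymbol m S) S
  c = correctLength m S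
  c′ = correctLength m S′

Good-receive : ∀ {m b} c h → Good m b h → Good m (suc b) (receive c h)
Good-receive {m} {b} c h good = subst (suc (rounds h + length (edit c S)) ≤_) (eq k′ b)
  (s≤s (+-≤-trans-cancel {rounds h} {length S} {2 * k} {2 * b} {suc (2 * k′)} good (correctLength-edit m c S)))
  where
  S = stack h
  k = correctLength m S
  k′ = correctLength m (edit c S)
  eq : ∀ a b → suc (suc (2 * a) + 2 * b) ≡ 2 * a + 2 * suc b
  eq = solve-∀

Good⇒rounds≤correctLength+2b : ∀ {m b} h → Good m b h → rounds h ≤ correctLength m (stack h) + 2 * b
Good⇒rounds≤correctLength+2b {m} {b} h good = +-cancelʳ-≤ c (rounds h) (c + 2 * b) (begin
  rounds h + c              ≤⟨ +-monoʳ-≤ (rounds h) (correctLength≤length m (stack h)) ⟩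
  rounds h + length (stack h) ≤⟨ good ⟩
  2 * c + 2 * b             ≡⟨ eq c b ⟩
  c + 2 * b + c             ∎)
  where
  open ≤-Reasoning
  c = correctLength m (stack h)
  eq : ∀ c b → 2 * c + 2 * b ≡ c + 2 * b + c
  eq = solve-∀

Open : ℕ → ℕ → Channel → Set
Open M N h = length (stack h) ℕ.< M × rounds h ℕ.< N

Closed : ℕ → ℕ → Channel → Set
Closed M N h = M ≤ length (stack h) ⊎ N ≤ rounds h

¬Open⇒Closed : ∀ {M N} h → ¬ Open M N h → Closed M N h
¬Open⇒Closed {M} {N} h ¬open with length (stack h) <? M
... | yes s<M = inj₂ (≮⇒≥ λ r<N → ¬open (s<M , r<N))
... | no  s≮M = inj₁ (≮⇒≥ s≮M)

record Bounded (M N : ℕ) (h : Channel) : Set where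
  field
    stack≤M      : length (stack h) ≤ M
    stack≤rounds : length (stack h) ≤ rounds h
    rounds≤N     : rounds h ≤ N
open Bounded public

Bounded-receive : ∀ {M N} c h → Open M N h → Bounded M N h → Bounded M N (receive c h)
Bounded-receive c h (s<M , r<N) bounded = record
  { stack≤M      = ≤-trans (length-edit c (stack h)) s<M
  ; stack≤rounds = ≤-trans (length-edit c (stack h)) (s≤s (stack≤rounds bounded))
  ; rounds≤N     = r<N
  }

module _ {n} (P : Protocol n) (x y : Bits n) (I : ℕ → Transcript → Set) where
  open Protocol P

  run-induction :
    (∀ {k T} → halt T ≡ false → I k T → I k (T ++ [ sent P x y T ])) →
    (∀ {k T} c → halt T ≡ false → I k T → I (suc k) (T ++ [ c ])) →
    ∀ {k} T rest → runsFrom P T rest → I k T → I (k + corruptionsFrom P x y T rest) (T ++ rest)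
  run-induction honest corrupt {k} T [] _ i = subst₂ I (sym (+-identityʳ k)) (sym (++-identityʳ T)) i
  run-induction honest corrupt {k} T (c ∷ rest) (running , runs) i with sent P x y T ≟ c
  ... | yes refl = subst (I _) (++-assoc T [ c ] rest)
                         (run-induction honest corrupt (T ++ [ c ]) rest runs (honest running i))
  ... | no  _    = subst₂ I (sym (+-suc k _)) (++-assoc T [ c ] rest)
                         (run-induction honest corrupt (T ++ [ c ]) rest runs (corrupt c running i))

module TwoPhase (n M N : ℕ) where

  open? : (h : Channel) → Dec (Open M N h)
  open? h = length (stack h) <? M ×-dec rounds h <? N

  -- Alice's channel (the symbols she sends), then Bob's.
  State : Set
  State = Channel × Channel

  initial : State
  initial = channel [] 0 , channel [] 0

  step : State → Sym → State
  step (a , b) c with open? a | open? b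
  ... | yes _ | _     = receive c a , b
  ... | no  _ | yes _ = a , receive c b
  ... | no  _ | no  _ = a , b

  halted : State → Bool
  halted (a , b) with open? a | open? b
  ... | yes _ | _     = false
  ... | no  _ | yes _ = false
  ... | no  _ | no  _ = true

  totalRounds : State → ℕ
  totalRounds (a , b) = rounds a + rounds b

  state : Transcript → State
  state = foldl step initial

  speakerOf : State → Party
  speakerOf (a , b) with open? a
  ... | yes _ = alice
  ... | no  _ = bob

  protocol : Protocol n
  protocol = record
    { speaker   = λ T → speakerOf (state T)
    ; halt      = λ T → halted (state T)
    ; aliceSend = λ x T → nextSymbol (bit x) (stack (proj₁ (state T)))
    ; bobSend   = λ y T → nextSymbol (bit y) (stack (proj₂ (state T)))
    ; aliceOut  = λ x T → x , decode n (stack (proj₂ (state T)))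
    ; bobOut    = λ y T → decode n (stack (proj₁ (state T))) , y
    }

  honestSymbol : Bits n → Bits n → State → Sym
  honestSymbol x y (a , b) with open? a
  ... | yes _ = nextSymbol (bit x) (stack a)
  ... | no  _ = nextSymbol (bit y) (stack b)

  sent≡honestSymbol : ∀ x y T → sent protocol x y T ≡ honestSymbol x y (state T)
  sent≡honestSymbol x y T with open? (proj₁ (state T))
  ... | yes _ = refl
  ... | no  _ = refl

  step-totalRounds : ∀ s c → halted s ≡ false → totalRounds (step s c) ≡ suc (totalRounds s)
  step-totalRounds (a , b) c running with open? a | open? b
  step-totalRounds (a , b) c running | yes _ | _     = refl
  step-totalRounds (a , b) c running | no  _ | yes _ = +-suc (rounds a) (rounds b)
  step-totalRounds (a , b) c ()      | no  _ | no  _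

  halted-step : ∀ s c → halted s ≡ true → step s c ≡ s
  halted-step (a , b) c stopped with open? a | open? b
  halted-step (a , b) c ()      | yes _ | _
  halted-step (a , b) c ()      | no  _ | yes _
  halted-step (a , b) c stopped | no  _ | no  _ = refl

  halted⇒Closed : ∀ s → halted s ≡ true → Closed M N (proj₁ s) × Closed M N (proj₂ s)
  halted⇒Closed (a , b) stopped with open? a | open? b
  halted⇒Closed (a , b) ()      | yes _  | _
  halted⇒Closed (a , b) ()      | no  _  | yes _
  halted⇒Closed (a , b) stopped | no  ¬a | no  ¬b = ¬Open⇒Closed a ¬a , ¬Open⇒Closed b ¬b

  BoundedState : State → Set
  BoundedState (a , b) = Bounded M N a × Bounded M N b

  step-BoundedState : ∀ s c → BoundedState s → BoundedState (step s c)
  step-BoundedState (a , b) c (ba , bb) with open? a | open? b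
  ... | yes oa | _     = Bounded-receive c a oa ba , bb
  ... | no  _  | yes ob = ba , Bounded-receive c b ob bb
  ... | no  _  | no  _  = ba , bb

  state-BoundedState : ∀ T → BoundedState (state T)
  state-BoundedState T = go initial T (init , init)
    where
    init : Bounded M N (channel [] 0)
    init = record { stack≤M = z≤n ; stack≤rounds = z≤n ; rounds≤N = z≤n }
    go : ∀ s T → BoundedState s → BoundedState (foldl step s T)
    go s []      bs = bs
    go s (c ∷ T) bs = go (step s c) T (step-BoundedState s c bs)

  halted-foldl : ∀ s T → halted s ≡ true → foldl step s T ≡ s
  halted-foldl s []      stopped = refl
  halted-foldl s (c ∷ T) stopped rewrite halted-step s c stopped = halted-foldl s T stopped

  foldl-halted⊎totalRounds : ∀ s T →
    halted (foldl step s T) ≡ true ⊎ totalRounds s + length T ≡ totalRounds (foldl step s T)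
  foldl-halted⊎totalRounds s []      = inj₂ (+-identityʳ (totalRounds s))
  foldl-halted⊎totalRounds s (c ∷ T) with halted s in e
  ... | true  = inj₁ (trans (cong halted (halted-foldl s (c ∷ T) e)) e)
  ... | false with foldl-halted⊎totalRounds (step s c) T
  ...   | inj₁ stopped = inj₁ stopped
  ...   | inj₂ counted = inj₂ (begin
    totalRounds s + suc (length T)  ≡⟨ +-suc (totalRounds s) (length T) ⟩
    suc (totalRounds s) + length T  ≡⟨ cong (_+ length T) (step-totalRounds s c e) ⟨
    totalRounds (step s c) + length T ≡⟨ counted ⟩
    totalRounds (foldl step (step s c) T) ∎)
    where open ≡-Reasoning

  alwaysTerminates : AlwaysTerminates protocol
  alwaysTerminates f with foldl-halted⊎totalRounds initial (applyUpTo f (suc (N + N)))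
  ... | inj₁ stopped = suc (N + N) , stopped
  ... | inj₂ counted = ⊥-elim (n≮n (N + N) (begin-strict
    N + N                             <⟨ n<1+n (N + N) ⟩
    suc (N + N)                       ≡⟨ length-applyUpTo f _ ⟨
    length (applyUpTo f (suc (N + N))) ≡⟨ counted ⟩
    totalRounds s                     ≤⟨ +-mono-≤ (rounds≤N ba) (rounds≤N bb) ⟩
    N + N                             ∎))
    where
    open ≤-Reasoning
    s = state (applyUpTo f (suc (N + N)))
    ba = proj₁ (state-BoundedState (applyUpTo f (suc (N + N))))
    bb = proj₂ (state-BoundedState (applyUpTo f (suc (N + N))))

  state-∷ʳ : ∀ T c → state (T ++ [ c ]) ≡ step (state T) c
  state-∷ʳ T c = foldl-∷ʳ step initial c T

  totalRounds-∷ʳ : ∀ T c → halted (state T) ≡ false → totalRounds (state T) ≡ length T →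
    totalRounds (state (T ++ [ c ])) ≡ length (T ++ [ c ])
  totalRounds-∷ʳ T c running counted = begin
    totalRounds (state (T ++ [ c ])) ≡⟨ cong totalRounds (state-∷ʳ T c) ⟩
    totalRounds (step (state T) c)   ≡⟨ step-totalRounds (state T) c running ⟩
    suc (totalRounds (state T))      ≡⟨ cong suc counted ⟩
    suc (length T)                   ≡⟨ +-comm 1 (length T) ⟩
    length T + 1                     ≡⟨ length-++ T ⟨
    length (T ++ [ c ])              ∎
    where open ≡-Reasoning

  module _ (x y : Bits n) where

    record GoodState (k : ℕ) (s : State) : Set where
      constructor goodState
      field
        b₁ b₂ : ℕ
        split : b₁ + b₂ ≡ k
        goodA : Good (bit x) b₁ (proj₁ s)
        goodB : Good (bit y) b₂ (proj₂ s)

    step-GoodState : ∀ {k} s c → halted s ≡ false → GoodState k s → GoodState (suc k) (step s c)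
    step-GoodState (a , b) c running (goodState b₁ b₂ refl ga gb) with open? a | open? b
    ... | yes _ | _     = goodState (suc b₁) b₂ refl (Good-receive c a ga) gb
    ... | no  _ | yes _ = goodState b₁ (suc b₂) (+-suc b₁ b₂) ga (Good-receive c b gb)
    step-GoodState (a , b) c () _ | no _ | no _

    step-honestSymbol-GoodState : ∀ {k} s → halted s ≡ false → GoodState k s →
      GoodState k (step s (honestSymbol x y s))
    step-honestSymbol-GoodState (a , b) running (goodState b₁ b₂ e ga gb) with open? a | open? b
    ... | yes _ | _     = goodState b₁ b₂ e (Good-receive-nextSymbol {b = b₁} a ga) gb
    ... | no  _ | yes _ = goodState b₁ b₂ e ga (Good-receive-nextSymbol {b = b₂} b gb)
    step-honestSymbol-GoodState (a , b) () _ | no _ | no _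

    record RunInvariant (k : ℕ) (T : Transcript) : Set where
      field
        counted : totalRounds (state T) ≡ length T
        good    : GoodState k (state T)

    RunInvariant-∷ʳ : ∀ {k T} c → halted (state T) ≡ false → totalRounds (state T) ≡ length T →
      GoodState k (step (state T) c) → RunInvariant k (T ++ [ c ])
    RunInvariant-∷ʳ {T = T} c running counted good = record
      { counted = totalRounds-∷ʳ T c running counted
      ; good    = subst (GoodState _) (sym (state-∷ʳ T c)) good
      }

    runInvariant : ∀ r → runsFrom protocol [] r → RunInvariant (corruptions protocol x y r) r
    runInvariant r runs = run-induction protocol x y RunInvariant honest corrupt [] r runs
      record { counted = refl ; good = goodState 0 0 refl z≤n z≤n }
      where
      honest : ∀ {k T} → halted (state T) ≡ false → RunInvariant k T → RunInvariant k (T ++ [ sent protocol x y T ])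
      honest {T = T} running record { counted = counted ; good = good } =
        RunInvariant-∷ʳ _ running counted
          (subst (GoodState _ ∘ step (state T)) (sym (sent≡honestSymbol x y T))
                 (step-honestSymbol-GoodState (state T) running good))
      corrupt : ∀ {k T} c → halted (state T) ≡ false → RunInvariant k T → RunInvariant (suc k) (T ++ [ c ])
      corrupt {T = T} c running record { counted = counted ; good = good } =
        RunInvariant-∷ʳ c running counted (step-GoodState (state T) c running good)

budget-exhausted : ∀ {q t b R K} → 1 ≤ q → 1 ≤ t →
  2 * q * b + 2 * R ≤ q * R → R + t ≤ K + 2 * b → q * K ≤ R → ⊥
budget-exhausted {q} {t} {b} {R} {K} 1≤q 1≤t budget short qK≤R = n≮n R (begin-strict
  R                 <⟨ s≤s (m≤n*m R 2) ⟩
  suc (2 * R)       ≤⟨ +-monoˡ-≤ (2 * R) (*-mono-≤ 1≤q 1≤t) ⟩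
  q * t + 2 * R     ≤⟨ scaled ⟩
  q * K             ≤⟨ qK≤R ⟩
  R                 ∎)
  where
  open ≤-Reasoning
  scaled : q * t + 2 * R ≤ q * K
  scaled = +-cancelʳ-≤ (q * R + 2 * q * b) _ _ (begin
    q * t + 2 * R + (q * R + 2 * q * b) ≡⟨ eq₁ q t b R ⟩
    q * (R + t) + (2 * q * b + 2 * R)   ≤⟨ +-mono-≤ (*-monoʳ-≤ q short) budget ⟩
    q * (K + 2 * b) + q * R             ≡⟨ eq₂ q b R K ⟩
    q * K + (q * R + 2 * q * b)         ∎)
    where
    eq₁ : ∀ q t b R → q * t + 2 * R + (q * R + 2 * q * b) ≡ q * (R + t) + (2 * q * b + 2 * R)
    eq₁ = solve-∀
    eq₂ : ∀ q b R K → q * (K + 2 * b) + q * R ≡ q * K + (q * R + 2 * q * b)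
    eq₂ = solve-∀

module Exchange (q n : ℕ) where

  M : ℕ
  M = 2 * q * n

  N : ℕ
  N = q * (n + M)

  open TwoPhase n M N public

  WithinBudget : ℕ → ℕ → Set
  WithinBudget b R = 2 * q * b + 2 * R ≤ q * R

  closed⇒n≤correctLength : ∀ {mA mB} a b b₁ b₂ → 1 ≤ q → WithinBudget (b₁ + b₂) (rounds a + rounds b) →
    Good mA b₁ a → Good mB b₂ b → Bounded M N a → Bounded M N b → Closed M N a →
    n ≤ correctLength mA (stack a)
  closed⇒n≤correctLength {mA} {mB} a b b₁ b₂ 1≤q budget goodA goodB boundedA boundedB closed
    with n ≤? correctLength mA (stack a)
  ... | yes n≤c = n≤c
  ... | no  n≰c = ⊥-elim (exhausted closed)
    where
    open ≤-Reasoning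
    c = correctLength mA (stack a)
    R = rounds a + rounds b
    c<n : suc c ≤ n
    c<n = ≰⇒> n≰c
    roundsB : rounds b ≤ M + 2 * b₂
    roundsB = ≤-trans (Good⇒rounds≤correctLength+2b {b = b₂} b goodB)
                      (+-monoˡ-≤ (2 * b₂) (≤-trans (correctLength≤length mB (stack b)) (stack≤M boundedB)))
    exhausted : Closed M N a → ⊥
    exhausted (inj₁ M≤s) = budget-exhausted {t = 2} {K = 2 * n} 1≤q (s≤s z≤n) budget short (begin
      q * (2 * n)         ≡⟨ eq q n ⟩
      M                   ≤⟨ M≤s ⟩
      length (stack a)    ≤⟨ stack≤rounds boundedA ⟩
      rounds a            ≤⟨ m≤m+n (rounds a) (rounds b) ⟩
      R                   ∎)
      where
      eq : ∀ q n → q * (2 * n) ≡ 2 * q * n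
      eq = solve-∀
      short : R + 2 ≤ 2 * n + 2 * (b₁ + b₂)
      short = begin
        rounds a + rounds b + 2           ≤⟨ +-monoˡ-≤ 2 (+-monoʳ-≤ (rounds a) roundsB) ⟩
        rounds a + (M + 2 * b₂) + 2       ≡⟨ eq₁ (rounds a) M b₂ ⟩
        rounds a + M + 2 * b₂ + 2         ≤⟨ +-monoˡ-≤ 2 (+-monoˡ-≤ (2 * b₂) (≤-trans (+-monoʳ-≤ (rounds a) M≤s) goodA)) ⟩
        2 * c + 2 * b₁ + 2 * b₂ + 2       ≡⟨ eq₂ c b₁ b₂ ⟩
        2 * suc c + 2 * (b₁ + b₂)         ≤⟨ +-monoˡ-≤ (2 * (b₁ + b₂)) (*-monoʳ-≤ 2 c<n) ⟩
        2 * n + 2 * (b₁ + b₂)             ∎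
        where
        eq₁ : ∀ r M b → r + (M + 2 * b) + 2 ≡ r + M + 2 * b + 2
        eq₁ = solve-∀
        eq₂ : ∀ c b₁ b₂ → 2 * c + 2 * b₁ + 2 * b₂ + 2 ≡ 2 * suc c + 2 * (b₁ + b₂)
        eq₂ = solve-∀
    exhausted (inj₂ N≤r) = budget-exhausted {t = 1} {K = n + M} 1≤q (s≤s z≤n) budget short
      (≤-trans N≤r (m≤m+n (rounds a) (rounds b)))
      where
      short : R + 1 ≤ n + M + 2 * (b₁ + b₂)
      short = begin
        rounds a + rounds b + 1               ≤⟨ +-monoˡ-≤ 1 (+-mono-≤ (Good⇒rounds≤correctLength+2b {b = b₁} a goodA) roundsB) ⟩
        c + 2 * b₁ + (M + 2 * b₂) + 1         ≡⟨ eq c b₁ b₂ M ⟩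
        suc c + M + 2 * (b₁ + b₂)             ≤⟨ +-monoˡ-≤ (2 * (b₁ + b₂)) (+-monoˡ-≤ M c<n) ⟩
        n + M + 2 * (b₁ + b₂)                 ∎
        where
        eq : ∀ c b₁ b₂ M → c + 2 * b₁ + (M + 2 * b₂) + 1 ≡ suc c + M + 2 * (b₁ + b₂)
        eq = solve-∀

  exchange : 1 ≤ q → ∀ x y r → TerminatingRun protocol r →
    WithinBudget (corruptions protocol x y r) (length r) →
    Protocol.aliceOut protocol x r ≡ (x , y) × Protocol.bobOut protocol y r ≡ (x , y)
  exchange 1≤q x y r (runs , stopped) budget =
      cong (x ,_) (decode-correct y (stack B) (closed⇒n≤correctLength B A b₂ b₁ 1≤q budgetB goodB goodA boundedB boundedA closedB))
    , cong (_, y) (decode-correct x (stack A) (closed⇒n≤correctLength A B b₁ b₂ 1≤q budgetA goodA goodB boundedA boundedB closedA))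
    where
    open RunInvariant (runInvariant x y r runs)
    open GoodState good
    A = proj₁ (state r)
    B = proj₂ (state r)
    closedA = proj₁ (halted⇒Closed (state r) stopped)
    closedB = proj₂ (halted⇒Closed (state r) stopped)
    boundedA = proj₁ (state-BoundedState r)
    boundedB = proj₂ (state-BoundedState r)
    budgetA : WithinBudget (b₁ + b₂) (rounds A + rounds B)
    budgetA = subst₂ WithinBudget (sym split) (sym counted) budget
    budgetB : WithinBudget (b₂ + b₁) (rounds B + rounds A)
    budgetB = subst₂ WithinBudget (+-comm b₁ b₂) (+-comm (rounds A) (rounds B)) budgetA

+n/1≡mkℚ : ∀ n → + n / 1 ≡ mkℚ (+ n) 0 (coprime-sym (1-coprimeTo n))
+n/1≡mkℚ n = normalize-coprime (coprime-sym (1-coprimeTo n))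

corruption-bound : ∀ b R p d .(c : Coprime p (suc d)) →
  (+ b / 1) ℚ.≤ (½ - mkℚ (+ p) d c) ℚ.* (+ R / 1) → 2 * suc d * b + 2 * p * R ≤ suc d * R
corruption-bound b R p d c b≤ rewrite +n/1≡mkℚ b | +n/1≡mkℚ R =
  ℤ.drop‿+≤+ (subst₂ ℤ._≤_ lhs rhs (ℤ.+-monoˡ-≤ (+ (2 * p * R)) cross-multiplied))
  where
  ε = mkℚ (+ p) d c
  R′ = mkℚ (+ R) 0 (coprime-sym (1-coprimeTo R))
  toℚᵘ-distrib : toℚᵘ ((½ - ε) ℚ.* R′) ℚᵘ.≃ (toℚᵘ ½ ℚᵘ.+ ℚᵘ.- toℚᵘ ε) ℚᵘ.* toℚᵘ R′
  toℚᵘ-distrib = ℚᵘ.≃-trans (toℚᵘ-homo-* (½ - ε) R′)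
    (ℚᵘ.*-congʳ (ℚᵘ.≃-trans (toℚᵘ-homo-+ ½ (ℚ.- ε)) (ℚᵘ.+-congʳ (toℚᵘ ½) (toℚᵘ-homo‿- ε))))
  numerator : ℤ
  numerator = ((+ 1 ℤ.* + suc d ℤ.+ ℤ.- + p ℤ.* + 2) ℤ.* + R) ℤ.* + 1
  cross-multiplied : + b ℤ.* + (2 * suc d * 1) ℤ.≤ numerator
  cross-multiplied with ℚᵘ.≤-respʳ-≃ toℚᵘ-distrib (toℚᵘ-mono-≤ b≤)
  ... | ℚᵘ.*≤* ≤ = ≤
  lhs : + b ℤ.* + (2 * suc d * 1) ℤ.+ + (2 * p * R) ≡ + (2 * suc d * b + 2 * p * R)
  lhs = begin
    + b ℤ.* + (2 * suc d * 1) ℤ.+ + (2 * p * R) ≡⟨ cong (ℤ._+ + (2 * p * R)) (ℤ.pos-* b _) ⟨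
    + (b * (2 * suc d * 1)) ℤ.+ + (2 * p * R) ≡⟨ ℤ.pos-+ _ (2 * p * R) ⟨
    + (b * (2 * suc d * 1) + 2 * p * R)     ≡⟨ cong +_ (eq b (suc d) (2 * p * R)) ⟩
    + (2 * suc d * b + 2 * p * R)             ∎
    where
    open ≡-Reasoning
    eq : ∀ b q x → b * (2 * q * 1) + x ≡ 2 * q * b + x
    eq = solve-∀
  rhs : numerator ℤ.+ + (2 * p * R) ≡ + (suc d * R)
  rhs = begin
    numerator ℤ.+ + (2 * p * R)
      ≡⟨ cong (ℤ._+_ numerator) (trans (ℤ.pos-* (2 * p) R) (cong (ℤ._* + R) (ℤ.pos-* 2 p))) ⟩
    numerator ℤ.+ + 2 ℤ.* + p ℤ.* + R
      ≡⟨ eq (+ suc d) (+ p) (+ R) ⟩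
    + suc d ℤ.* + R
      ≡⟨ ℤ.pos-* (suc d) R ⟨
    + (suc d * R) ∎
    where
    open ≡-Reasoning
    eq : ∀ q p R → ((+ 1 ℤ.* q ℤ.+ ℤ.- p ℤ.* + 2) ℤ.* R) ℤ.* + 1 ℤ.+ + 2 ℤ.* p ℤ.* R ≡ q ℤ.* R
    eq = ℤ-Solver.solve-∀

theorem1p4 : (ε : ℚ) → 0ℚ < ε → (n : ℕ) →
    Σ (Protocol n) λ P → AlwaysTerminates P × Resilient P (½ - ε)
theorem1p4 (mkℚ (+ zero) d c) (ℚ.*<* (ℤ.+<+ ())) n
theorem1p4 (mkℚ -[1+ _ ] d c) (ℚ.*<* ())          n
theorem1p4 (mkℚ +[1+ k ] d c) _                   n = protocol , alwaysTerminates , resilient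
  where
  open Exchange (suc d) n
  resilient : Resilient protocol (½ - mkℚ +[1+ k ] d c)
  resilient x y r run b≤ = exchange (s≤s z≤n) x y r run (begin
    2 * suc d * b + 2 * length r         ≤⟨ +-monoʳ-≤ (2 * suc d * b) (*-monoˡ-≤ (length r) (m≤m*n 2 (suc k))) ⟩
    2 * suc d * b + 2 * suc k * length r ≤⟨ corruption-bound b (length r) (suc k) d c b≤ ⟩
    suc d * length r                     ∎)
    where
    open ≤-Reasoning
    b = corruptions protocol x y r
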